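{- Let $G=(V,E)$ be a simple, connected, undirected graph with $V=\{1,\ldots,n\}$. If $G$ has a complete maximal independent set $A$, then $A$ is the unique complete maximal independent set of $G$, and moreover $[A\setminus Int(A);\,A\cup Ext(A)]=2^V$.
   Context: The labels give the linear order on $V$; $N(v)$ is the neighbourhood of $v$. For an independent set $A$: $Ext(A)=\{v\in V\setminus A:\ \exists a\in A,\ a\in N(v),\ v>a\}$; for $v\in A$, $Subs(v)=\{u\in N(v): (A\setminus\{v\})\cup\{u\}\text{ independent}\}$, and $v$ is internally active if $Subs(v)=\emptyset$ or $v>\max Subs(v)$; $Int(A)$ is the set of internally active vertices of $A$. A maximal independent set $S$ is complete if $Int(S)=S$ and $Ext(S)=V\setminus S$. $[X;Y]=\{Z: X\subseteq Z\subseteq Y\}$. -}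

module Defs where

open import Data.Nat using (ℕ)
open import Data.Fin using (Fin; _<_)
open import Data.Fin.Subset using (Subset; _∈_; _∉_; _⊆_; _∪_; _-_; ⁅_⁆)
open import Data.Product using (Σ; _×_; ∃-syntax)
open import Data.Sum using (_⊎_)
open import Relation.Nullary using (¬_)
open import Relation.Binary.PropositionalEquality using (_≡_)
open import Relation.Binary.Construct.Closure.ReflexiveTransitive using (Star)

-- A simple undirected graph on the vertex set V = Fin n (labels 0..n-1,
-- ordered as 1..n in the paper; the linear order is Fin's _<_).
record Graph (n : ℕ) : Set₁ where
  field
    Adj     : Fin n → Fin n → Set
    sym     : ∀ {u v} → Adj u v → Adj v u
    irrefl  : ∀ {v} → ¬ Adj v v

module _ {n : ℕ} (G : Graph n) where
  open Graph G

  Connected : Set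
  Connected = ∀ u v → Star Adj u v

  Independent : Subset n → Set
  Independent A = ∀ u v → u ∈ A → v ∈ A → ¬ Adj u v

  MaximalIndependent : Subset n → Set
  MaximalIndependent A =
    Independent A × (∀ B → Independent B → A ⊆ B → B ≡ A)

  InExt : Subset n → Fin n → Set
  InExt A v = v ∉ A × ∃[ a ] (a ∈ A × Adj v a × a < v)

  InSubs : Subset n → Fin n → Fin n → Set
  InSubs A v u = Adj v u × Independent ((A - v) ∪ ⁅ u ⁆)

  -- v ∈ Int(A): v ∈ A and (Subs(v) = ∅ or v > max Subs(v)),
  -- i.e. every element of Subs(v) is smaller than v
  InInt : Subset n → Fin n → Set
  InInt A v = v ∈ A × (∀ u → InSubs A v u → u < v)

  -- complete maximal independent set: Int(S) = S and Ext(S) = V \ S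
  -- (Int(S) ⊆ S and Ext(S) ⊆ V \ S hold by definition)
  Complete : Subset n → Set
  Complete S = MaximalIndependent S
             × (∀ v → v ∈ S → InInt S v)
             × (∀ v → v ∉ S → InExt S v)

  -- [A \ Int(A) ; A ∪ Ext(A)] = 2^V : every subset Z of V lies in the interval
  IntervalIsAll : Subset n → Set
  IntervalIsAll A =
    ∀ (Z : Subset n) →
      (∀ v → v ∈ A → ¬ InInt A v → v ∈ Z)
      × (∀ v → v ∈ Z → v ∈ A ⊎ InExt A v)

-- A vertex v lies in a complete set S exactly when no smaller neighbour of v lies in S:
-- if v ∉ S, then v ∈ Ext(S) provides such a neighbour, and if v ∈ S, independence forbids one.
-- So S is determined from the bottom up by the vertex order, which forces uniqueness.
-- Since Int(A) = A and A ∪ Ext(A) = V, the interval [A \ Int(A); A ∪ Ext(A)] is [∅; V].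
module Submission where

open import Defs
open import Data.Nat using (ℕ)
open import Data.Fin using (_<_)
open import Data.Fin.Induction using (<-wellFounded)
open import Data.Fin.Subset using (Subset; _∈_; _∉_)
open import Data.Fin.Subset.Properties using (_∈?_; ⊆-antisym)
open import Data.Product using (_×_; _,_)
open import Data.Sum using (_⊎_; inj₁; inj₂)
open import Function using (_⇔_; mk⇔; Equivalence)
open import Induction.WellFounded using (module All)
open import Relation.Nullary using (yes; no; contradiction)
open import Relation.Binary.PropositionalEquality using (_≡_)

module _ {n : ℕ} (G : Graph n) where
  open Graph G

  ExtCovers : Subset n → Set
  ExtCovers S = ∀ v → v ∉ S → InExt G S v

  ∈-transfer : ∀ {S T} → Independent G S → ExtCovers T → ∀ v
             → (∀ {a} → a < v → a ∈ T → a ∈ S) → v ∈ S → v ∈ T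
  ∈-transfer {T = T} indS covT v below v∈S with v ∈? T
  ... | yes v∈T = v∈T
  ... | no v∉T with covT v v∉T
  ... | _ , a , a∈T , v~a , a<v = contradiction v~a (indS v a v∈S (below a<v a∈T))

  independent-extCovers-unique : ∀ {S T}
    → Independent G S → ExtCovers S → Independent G T → ExtCovers T → S ≡ T
  independent-extCovers-unique {S} {T} indS covS indT covT =
    ⊆-antisym (Equivalence.to (agree _)) (Equivalence.from (agree _))
    where
    open All <-wellFounded _ using (wfRec)

    agree : ∀ v → (v ∈ S) ⇔ (v ∈ T)
    agree = wfRec (λ v → (v ∈ S) ⇔ (v ∈ T)) λ v ih →
      mk⇔ (∈-transfer indS covT v (λ a<v → Equivalence.from (ih a<v)))
          (∈-transfer indT covS v (λ a<v → Equivalence.to (ih a<v)))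

  complete-unique : ∀ {S T} → Complete G S → Complete G T → S ≡ T
  complete-unique ((indS , _) , _ , covS) ((indT , _) , _ , covT) =
    independent-extCovers-unique indS covS indT covT

  complete⇒intervalIsAll : ∀ {A} → Complete G A → IntervalIsAll G A
  complete⇒intervalIsAll {A} (_ , allInt , covA) Z =
    (λ v v∈A v∉Int → contradiction (allInt v v∈A) v∉Int) , λ v _ → ∈-or-ext v
    where
    ∈-or-ext : ∀ v → v ∈ A ⊎ InExt G A v
    ∈-or-ext v with v ∈? A
    ... | yes v∈A = inj₁ v∈A
    ... | no v∉A = inj₂ (covA v v∉A)

theorem4 : (n : ℕ) (G : Graph n) → Connected G → (A : Subset n) → Complete G A
         → ((B : Subset n) → Complete G B → B ≡ A) × IntervalIsAll G A
theorem4 n G _ A cA = (λ B cB → complete-unique G cB cA) , complete⇒intervalIsAll G cA
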